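{- Let $g_1,g_2$ be positive integers and $G=G_1\times G_2$ an abelian group. (1) If $D_i$ is a $g_i$-additive basis of $G_i$ for $i\in\{1,2\}$, then $D_1\times D_2$ is a $g_1g_2$-additive basis of $G_1\times G_2$. Consequently (for finite groups, whenever the right side exists) $\nu_{g_1g_2}(G_1\times G_2)\le \nu_{g_1}(G_1)\nu_{g_2}(G_2)$. (2) If $D_i$ is a $g_i$-difference basis of $G_i$ for $i\in\{1,2\}$, then $D_1\times D_2$ is a $g_1g_2$-difference basis of $G_1\times G_2$. Consequently (for finite groups, whenever the right side exists) $\eta_{g_1g_2}(G_1\times G_2)\le \eta_{g_1}(G_1)\eta_{g_2}(G_2)$.
   Context: For an abelian group $G$ and $A\subseteq G$, let $r_{A+A}(x)=|\{(a,b)\in A\times A: a+b=x\}|$ and $r_{A-A}(x)=|\{(a,b)\in A\times A: a-b=x\}|$. For a positive integer $g$, $A$ is a $g$-additive basis of $G$ if $r_{A+A}(x)\ge g$ for all $x\in G$ and a $g$-difference basis of $G$ if $r_{A-A}(x)\ge g$ for all $x\in G$. For finite $G$, $\nu_g(G)$ (resp. $\eta_g(G)$) is the minimum size of a $g$-additive (resp. $g$-difference) basis of $G$. -}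

module Defs where

open import Level using (Level; _⊔_)
open import Data.Nat using (ℕ; _≤_)
open import Data.Fin using (Fin)
open import Data.Product using (Σ; ∃; _×_; _,_; proj₁; proj₂)
open import Relation.Binary.PropositionalEquality using (_≡_)
open import Relation.Unary using (Pred)
open import Algebra.Bundles using (AbelianGroup)

private
  variable
    c ℓ ℓa : Level

module _ (G : AbelianGroup c ℓ) where
  open AbelianGroup G

  InjectiveEnum : {n : ℕ} → (Fin n → Carrier) → Set ℓ
  InjectiveEnum e = ∀ i j → e i ≈ e j → i ≡ j

  Image : {n : ℕ} → (Fin n → Carrier) → Pred Carrier ℓ
  Image {n} e x = ∃ λ (i : Fin n) → e i ≈ x

  RSumAtLeast : Pred Carrier ℓa → Carrier → ℕ → Set (c ⊔ ℓ ⊔ ℓa)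
  RSumAtLeast A x g =
    Σ (Fin g → Carrier × Carrier) λ f →
      (∀ i → A (proj₁ (f i)) × A (proj₂ (f i)) × (proj₁ (f i) ∙ proj₂ (f i) ≈ x))
      × (∀ i j → proj₁ (f i) ≈ proj₁ (f j) → proj₂ (f i) ≈ proj₂ (f j) → i ≡ j)

  RDiffAtLeast : Pred Carrier ℓa → Carrier → ℕ → Set (c ⊔ ℓ ⊔ ℓa)
  RDiffAtLeast A x g =
    Σ (Fin g → Carrier × Carrier) λ f →
      (∀ i → A (proj₁ (f i)) × A (proj₂ (f i)) × (proj₁ (f i) ∙ (proj₂ (f i) ⁻¹) ≈ x))
      × (∀ i j → proj₁ (f i) ≈ proj₁ (f j) → proj₂ (f i) ≈ proj₂ (f j) → i ≡ j)

  IsAdditiveBasis : ℕ → Pred Carrier ℓa → Set (c ⊔ ℓ ⊔ ℓa)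
  IsAdditiveBasis g A = ∀ x → RSumAtLeast A x g

  IsDifferenceBasis : ℕ → Pred Carrier ℓa → Set (c ⊔ ℓ ⊔ ℓa)
  IsDifferenceBasis g A = ∀ x → RDiffAtLeast A x g

  IsNu : ℕ → ℕ → Set (c ⊔ ℓ)
  IsNu g n =
    (Σ (Fin n → Carrier) λ e → InjectiveEnum e × IsAdditiveBasis g (Image e))
    × (∀ m (e : Fin m → Carrier) → InjectiveEnum e → IsAdditiveBasis g (Image e) → n ≤ m)

  IsEta : ℕ → ℕ → Set (c ⊔ ℓ)
  IsEta g n =
    (Σ (Fin n → Carrier) λ e → InjectiveEnum e × IsDifferenceBasis g (Image e))
    × (∀ m (e : Fin m → Carrier) → InjectiveEnum e → IsDifferenceBasis g (Image e) → n ≤ m)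

_⊠_ : {a b ℓ₁ ℓ₂ : Level} {A : Set a} {B : Set b} → Pred A ℓ₁ → Pred B ℓ₂ → Pred (A × B) (ℓ₁ ⊔ ℓ₂)
(D₁ ⊠ D₂) (x , y) = D₁ x × D₂ y

{-# OPTIONS --safe #-}
-- If the pairs (aᵢ , bᵢ), i < g₁, are distinct representations of x₁ by D₁ and the pairs
-- (a'ⱼ , b'ⱼ), j < g₂, of x₂ by D₂, then the g₁ g₂ pairs ((aᵢ , a'ⱼ) , (bᵢ , b'ⱼ)) are
-- distinct representations of (x₁ , x₂) by D₁ × D₂, because the operation of G₁ × G₂ is
-- componentwise. Nothing else about the operation is used, so sums and differences are
-- handled at once. Taking D₁ and D₂ of minimum size yields a g₁ g₂-basis of size n₁ n₂,
-- whence the bounds on ν and η.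
module Submission where

open import Defs
open import Level using (Level; _⊔_)
open import Data.Nat using (ℕ; _*_; _≤_; NonZero)
open import Data.Fin using (Fin; remQuot; combine)
open import Data.Fin.Properties using (*↔×; remQuot-combine)
open import Data.Product using (Σ; _×_; _,_; proj₁; proj₂; map; zip′; uncurry)
open import Data.Product.Relation.Binary.Pointwise.NonDependent using (Pointwise)
open import Function using (_∘_; Injection)
open import Function.Definitions using (Injective)
open import Function.Properties.Inverse using (Inverse⇒Injection)
open import Relation.Binary.Core using (Rel)
open import Relation.Binary.PropositionalEquality using (_≡_; cong; cong₂; subst; sym)
open import Relation.Unary using (Pred; _⊆_)
open import Algebra.Core using (Op₂)
open import Algebra.Bundles using (AbelianGroup)
open import Algebra.Construct.DirectProduct using (abelianGroup)

private
  variable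
    a b c d ℓ ℓ₁ ℓ₂ p q : Level
    A : Set a
    B : Set b
    C : Set c
    D : Set d

remQuot-injective : ∀ {m} n → Injective _≡_ _≡_ (remQuot {m} n)
remQuot-injective {m} n = Injection.injective (Inverse⇒Injection (*↔× {m} {n}))

_⊗ᶠ_ : ∀ {m n} → (Fin m → A) → (Fin n → B) → Fin (m * n) → A × B
_⊗ᶠ_ {n = n} f h = map f h ∘ remQuot n

⊗ᶠ-injective : ∀ {m n} {R : Rel A ℓ₁} {S : Rel B ℓ₂} {f : Fin m → A} {h : Fin n → B} →
  Injective _≡_ R f → Injective _≡_ S h → Injective _≡_ (Pointwise R S) (f ⊗ᶠ h)
⊗ᶠ-injective {n = n} f-inj h-inj (r , s) = remQuot-injective n (cong₂ _,_ (f-inj r) (h-inj s))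

⊗ᶠ-combine : ∀ {m n} (f : Fin m → A) (h : Fin n → B) i j → (f ⊗ᶠ h) (combine i j) ≡ (f i , h j)
⊗ᶠ-combine f h i j = cong (map f h) (remQuot-combine i j)

transpose : (A × B) × (C × D) → (A × C) × (B × D)
transpose ((a₁ , b₁) , (a₂ , b₂)) = (a₁ , a₂) , (b₁ , b₂)

-- IsAdditiveBasis G g and IsDifferenceBasis G g are definitionally IsBasisFor _≈_ _∙_ g and
-- IsBasisFor _≈_ _-_ g, and IsNu, IsEta are the corresponding IsMinimumBasisSize below.
module _ {X : Set a} (_≈_ : Rel X ℓ) where

  DistinctPairs : Pred (X × X) p → ℕ → Set (a ⊔ ℓ ⊔ p)
  DistinctPairs P g =
    Σ (Fin g → X × X) λ f →
      (∀ i → P (f i)) × (∀ i j → proj₁ (f i) ≈ proj₁ (f j) → proj₂ (f i) ≈ proj₂ (f j) → i ≡ j)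

  Representation : Op₂ X → Pred X p → X → Pred (X × X) (ℓ ⊔ p)
  Representation _⊕_ D x (d , e) = D d × D e × ((d ⊕ e) ≈ x)

  IsBasisFor : Op₂ X → ℕ → Pred X p → Set (a ⊔ ℓ ⊔ p)
  IsBasisFor _⊕_ g D = ∀ x → DistinctPairs (Representation _⊕_ D x) g

  DistinctPairs-mono : ∀ {P : Pred (X × X) p} {Q : Pred (X × X) q} {g} →
    P ⊆ Q → DistinctPairs P g → DistinctPairs Q g
  DistinctPairs-mono P⊆Q (f , f∈P , f-distinct) = f , P⊆Q ∘ f∈P , f-distinct

  IsBasisFor-mono : ∀ {_⊕_ g} {D : Pred X p} {E : Pred X q} →
    D ⊆ E → IsBasisFor _⊕_ g D → IsBasisFor _⊕_ g E
  IsBasisFor-mono {_⊕_ = _⊕_} {D = D} {E} D⊆E basis x =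
    DistinctPairs-mono {P = Representation _⊕_ D x} {Q = Representation _⊕_ E x}
      (λ (d∈D , e∈D , d⊕e≈x) → D⊆E d∈D , D⊆E e∈D , d⊕e≈x) (basis x)

module _ {X₁ : Set a} {X₂ : Set b} (_≈₁_ : Rel X₁ ℓ₁) (_≈₂_ : Rel X₂ ℓ₂) where

  DistinctPairs-× : ∀ {P₁ : Pred (X₁ × X₁) p} {P₂ : Pred (X₂ × X₂) q} {g₁ g₂} →
    DistinctPairs _≈₁_ P₁ g₁ → DistinctPairs _≈₂_ P₂ g₂ →
    DistinctPairs (Pointwise _≈₁_ _≈₂_) ((P₁ ⊠ P₂) ∘ transpose) (g₁ * g₂)
  DistinctPairs-× (f₁ , f₁∈P₁ , f₁-distinct) (f₂ , f₂∈P₂ , f₂-distinct) =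
    transpose ∘ (f₁ ⊗ᶠ f₂) , (λ _ → f₁∈P₁ _ , f₂∈P₂ _) ,
    λ _ _ r s → f₁⊗f₂-injective (transpose (r , s))
    where
    f₁⊗f₂-injective : Injective _≡_ (Pointwise (Pointwise _≈₁_ _≈₁_) (Pointwise _≈₂_ _≈₂_)) (f₁ ⊗ᶠ f₂)
    f₁⊗f₂-injective =
      ⊗ᶠ-injective {R = Pointwise _≈₁_ _≈₁_} {S = Pointwise _≈₂_ _≈₂_}
        (uncurry (f₁-distinct _ _)) (uncurry (f₂-distinct _ _))

  IsBasisFor-× : ∀ (_⊕₁_ : Op₂ X₁) (_⊕₂_ : Op₂ X₂) {g₁ g₂} (D₁ : Pred X₁ p) (D₂ : Pred X₂ q) →
    IsBasisFor _≈₁_ _⊕₁_ g₁ D₁ → IsBasisFor _≈₂_ _⊕₂_ g₂ D₂ →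
    IsBasisFor (Pointwise _≈₁_ _≈₂_) (zip′ _⊕₁_ _⊕₂_) (g₁ * g₂) (D₁ ⊠ D₂)
  IsBasisFor-× _⊕₁_ _⊕₂_ D₁ D₂ basis₁ basis₂ (x₁ , x₂) =
    DistinctPairs-mono (Pointwise _≈₁_ _≈₂_)
      {P = (Representation _≈₁_ _⊕₁_ D₁ x₁ ⊠ Representation _≈₂_ _⊕₂_ D₂ x₂) ∘ transpose}
      (λ ((d₁ , e₁ , r₁) , (d₂ , e₂ , r₂)) → (d₁ , d₂) , (e₁ , e₂) , (r₁ , r₂))
      (DistinctPairs-× {P₁ = Representation _≈₁_ _⊕₁_ D₁ x₁} {P₂ = Representation _≈₂_ _⊕₂_ D₂ x₂}
        (basis₁ x₁) (basis₂ x₂))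

module _ (G : AbelianGroup c ℓ) where
  open AbelianGroup G

  IsMinimumBasisSize : Pred (Pred Carrier ℓ) p → ℕ → Set (c ⊔ ℓ ⊔ p)
  IsMinimumBasisSize IsBasis n =
    (Σ (Fin n → Carrier) λ e → InjectiveEnum G e × IsBasis (Image G e))
    × (∀ m (e : Fin m → Carrier) → InjectiveEnum G e → IsBasis (Image G e) → n ≤ m)

module _ (G₁ : AbelianGroup a ℓ₁) (G₂ : AbelianGroup b ℓ₂) where
  private
    module G₁ = AbelianGroup G₁
    module G₂ = AbelianGroup G₂
    G = abelianGroup G₁ G₂

  InjectiveEnum-⊗ᶠ : ∀ {n₁ n₂} {e₁ : Fin n₁ → G₁.Carrier} {e₂ : Fin n₂ → G₂.Carrier} →
    InjectiveEnum G₁ e₁ → InjectiveEnum G₂ e₂ → InjectiveEnum G (e₁ ⊗ᶠ e₂)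
  InjectiveEnum-⊗ᶠ e₁-inj e₂-inj _ _ =
    ⊗ᶠ-injective {R = G₁._≈_} {S = G₂._≈_} (e₁-inj _ _) (e₂-inj _ _)

  Image-⊗ᶠ : ∀ {n₁ n₂} (e₁ : Fin n₁ → G₁.Carrier) (e₂ : Fin n₂ → G₂.Carrier) →
    Image G₁ e₁ ⊠ Image G₂ e₂ ⊆ Image G (e₁ ⊗ᶠ e₂)
  Image-⊗ᶠ e₁ e₂ {x₁ , x₂} ((i , eᵢ≈x₁) , (j , eⱼ≈x₂)) =
    combine i j , subst (λ y → Pointwise G₁._≈_ G₂._≈_ y (x₁ , x₂))
                        (sym (⊗ᶠ-combine e₁ e₂ i j)) (eᵢ≈x₁ , eⱼ≈x₂)

  minimumBasisSize-× : ∀ (_⊕₁_ : Op₂ G₁.Carrier) (_⊕₂_ : Op₂ G₂.Carrier) {g₁ g₂ n₁ n₂ m} →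
    IsMinimumBasisSize G₁ (IsBasisFor G₁._≈_ _⊕₁_ g₁) n₁ →
    IsMinimumBasisSize G₂ (IsBasisFor G₂._≈_ _⊕₂_ g₂) n₂ →
    IsMinimumBasisSize G (IsBasisFor (Pointwise G₁._≈_ G₂._≈_) (zip′ _⊕₁_ _⊕₂_) (g₁ * g₂)) m →
    m ≤ n₁ * n₂
  minimumBasisSize-× _⊕₁_ _⊕₂_ ((e₁ , e₁-inj , e₁-basis) , _) ((e₂ , e₂-inj , e₂-basis) , _)
                     (_ , minimal) =
    minimal _ (e₁ ⊗ᶠ e₂) (InjectiveEnum-⊗ᶠ e₁-inj e₂-inj)
      (IsBasisFor-mono (Pointwise G₁._≈_ G₂._≈_)
        {_⊕_ = zip′ _⊕₁_ _⊕₂_} {D = Image G₁ e₁ ⊠ Image G₂ e₂} (Image-⊗ᶠ e₁ e₂)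
        (IsBasisFor-× G₁._≈_ G₂._≈_ _⊕₁_ _⊕₂_ (Image G₁ e₁) (Image G₂ e₂) e₁-basis e₂-basis))

corollary2p2 : {c₁ c₂ ℓ₁ ℓ₂ a₁ a₂ : Level}
    (G₁ : AbelianGroup c₁ ℓ₁) (G₂ : AbelianGroup c₂ ℓ₂)
    (g₁ g₂ : ℕ) → .{{NonZero g₁}} → .{{NonZero g₂}} →
    ((D₁ : Pred (AbelianGroup.Carrier G₁) a₁) (D₂ : Pred (AbelianGroup.Carrier G₂) a₂) →
      IsAdditiveBasis G₁ g₁ D₁ → IsAdditiveBasis G₂ g₂ D₂ →
      IsAdditiveBasis (abelianGroup G₁ G₂) (g₁ * g₂) (D₁ ⊠ D₂))
    × ((n₁ n₂ m : ℕ) → IsNu G₁ g₁ n₁ → IsNu G₂ g₂ n₂ →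
      IsNu (abelianGroup G₁ G₂) (g₁ * g₂) m → m ≤ n₁ * n₂)
    × ((D₁ : Pred (AbelianGroup.Carrier G₁) a₁) (D₂ : Pred (AbelianGroup.Carrier G₂) a₂) →
      IsDifferenceBasis G₁ g₁ D₁ → IsDifferenceBasis G₂ g₂ D₂ →
      IsDifferenceBasis (abelianGroup G₁ G₂) (g₁ * g₂) (D₁ ⊠ D₂))
    × ((n₁ n₂ m : ℕ) → IsEta G₁ g₁ n₁ → IsEta G₂ g₂ n₂ →
      IsEta (abelianGroup G₁ G₂) (g₁ * g₂) m → m ≤ n₁ * n₂)
corollary2p2 G₁ G₂ g₁ g₂ =
    IsBasisFor-× G₁._≈_ G₂._≈_ G₁._∙_ G₂._∙_
  , (λ _ _ _ → minimumBasisSize-× G₁ G₂ G₁._∙_ G₂._∙_)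
  , IsBasisFor-× G₁._≈_ G₂._≈_ G₁._-_ G₂._-_
  , (λ _ _ _ → minimumBasisSize-× G₁ G₂ G₁._-_ G₂._-_)
  where
  module G₁ = AbelianGroup G₁
  module G₂ = AbelianGroup G₂
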